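{- Let $D$ be a positive integer, let $Q_D$ be the $D$-cube with vertex set $\mathcal X$, adjacency matrix $\mathbf A$ and base vertex $\mathbf x$, let $\mathbf A^*_{D-1}$ be the diagonal matrix whose $(\mathbf y,\mathbf y)$-entry is $(-1)^i(D-2i)$ with $i=\partial(\mathbf x,\mathbf y)$, and let $\mathbf C=\tfrac12(\mathbf A\mathbf A^*_{D-1}+\mathbf A^*_{D-1}\mathbf A)$. Then $\mathbf C$ is a weighted adjacency matrix for $Q_D$, and for adjacent $\mathbf y,\mathbf z\in\mathcal X$ the $(\mathbf y,\mathbf z)$-entry of $\mathbf C$ is $(-1)^i$, where $i=\min\{\partial(\mathbf x,\mathbf y),\partial(\mathbf x,\mathbf z)\}$.
   Context: $Q_D$ has vertex set $\mathcal X=\{0,1\}^D$, two vertices adjacent iff they differ in exactly one coordinate; $\partial$ is the Hamming distance. The matrix $\mathbf A^*_{D-1}$ equals the diagonal matrix with $(\mathbf y,\mathbf y)$-entry $|\mathcal X|(\mathbf E_{D-1})_{\mathbf x\mathbf y}$, where $\mathbf E_{D-1}$ is the primitive idempotent of $\mathbf A$ for the eigenvalue $2-D$; $\mathbf C$ is the action of $z$ under the $\mathcal A$-module structure on $\mathbb C^{\mathcal X}$ with $x\mapsto\mathbf A$, $y\mapsto\mathbf A^*_{D-1}$ (relations $xy+yx=2z$, $yz+zy=2x$, $zx+xz=2y$). A matrix $\mathbf N$ indexed by the vertex set of a graph is a weighted adjacency matrix if $\mathbf N_{\mathbf y\mathbf z}\ne0$ for all adjacent $\mathbf y,\mathbf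 z$ and $\mathbf N_{\mathbf y\mathbf z}=0$ for all nonadjacent $\mathbf y,\mathbf z$. -}

module Defs where

open import Data.Bool using (Bool; true; false; if_then_else_)
open import Data.Nat using (ℕ; zero; suc; _*_; _⊓_)
open import Data.Nat.Properties using () renaming (_≟_ to _≟ℕ_)
open import Data.Integer using (ℤ; +_)
open import Data.Rational using (ℚ; 0ℚ; 1ℚ; ½; _+_; _-_; -_; _/_) renaming (_*_ to _*ℚ_)
open import Data.List using (List; []; _∷_; map; _++_; foldr)
open import Data.Vec using (Vec; []; _∷_)
open import Data.Vec.Properties using (≡-dec)
open import Relation.Nullary using (does)
import Data.Bool.Properties as BoolP

Vertex : ℕ → Set
Vertex D = Vec Bool D

allVertices : (D : ℕ) → List (Vertex D)
allVertices zero = [] ∷ []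
allVertices (suc D) = map (false ∷_) (allVertices D) ++ map (true ∷_) (allVertices D)

hamming : ∀ {D} → Vertex D → Vertex D → ℕ
hamming [] [] = zero
hamming (a ∷ u) (b ∷ v) = (if does (a BoolP.≟ b) then 0 else 1) Data.Nat.+ hamming u v

Adjacent : ∀ {D} → Vertex D → Vertex D → Set
Adjacent y z = hamming y z ≡ 1
  where open import Relation.Binary.PropositionalEquality using (_≡_)

Matrix : ℕ → Set
Matrix D = Vertex D → Vertex D → ℚ

sumℚ : List ℚ → ℚ
sumℚ = foldr _+_ 0ℚ

_·_ : ∀ {D} → Matrix D → Matrix D → Matrix D
_·_ {D} M N y z = sumℚ (map (λ w → M y w *ℚ N w z) (allVertices D))

_⊕_ : ∀ {D} → Matrix D → Matrix D → Matrix D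
(M ⊕ N) y z = M y z + N y z

_⋆_ : ∀ {D} → ℚ → Matrix D → Matrix D
(c ⋆ M) y z = c *ℚ M y z

negOnePow : ℕ → ℚ
negOnePow zero = 1ℚ
negOnePow (suc i) = - negOnePow i

ℕtoℚ : ℕ → ℚ
ℕtoℚ n = + n / 1

adjMatrix : (D : ℕ) → Matrix D
adjMatrix D y z = if does (hamming y z ≟ℕ 1) then 1ℚ else 0ℚ

dualAdj : (D : ℕ) → Vertex D → Matrix D
dualAdj D x y z =
  if does (≡-dec BoolP._≟_ y z)
  then negOnePow (hamming x y) *ℚ (ℕtoℚ D - ℕtoℚ (2 * hamming x y))
  else 0ℚ

Cmatrix : (D : ℕ) → Vertex D → Matrix D
Cmatrix D x = ½ ⋆ ((adjMatrix D · dualAdj D x) ⊕ (dualAdj D x · adjMatrix D))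

IsWeightedAdjacency : (D : ℕ) → Matrix D → Set
IsWeightedAdjacency D N =
  (∀ (y z : Vertex D) → Adjacent y z → ¬ (N y z ≡ 0ℚ)) ×
  (∀ (y z : Vertex D) → ¬ Adjacent y z → N y z ≡ 0ℚ)
  where
  open import Relation.Binary.PropositionalEquality using (_≡_)
  open import Relation.Nullary using (¬_)
  open import Data.Product using (_×_)

module Submission where

-- Write θ i = (-1)^i (D - 2i), so that 𝐀* = 𝐀*_{D-1} is the
-- diagonal matrix y ↦ θ ∂(x,y).  Multiplying by a diagonal matrix only
-- rescales entries, hence
--     𝐂 y z = ½ (𝐀 y z · θ ∂(x,z) + θ ∂(x,y) · 𝐀 y z).
-- If y, z are not adjacent then 𝐀 y z = 0, so 𝐂 y z = 0.  If they are adjacent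
-- then 𝐀 y z = 1, and their distances to x are consecutive integers i, i+1;
-- the identity ½ (θ i + θ (i+1)) = (-1)^i then gives 𝐂 y z = (-1)^min, which
-- is nonzero, so 𝐂 is a weighted adjacency matrix.

open import Defs
open import Data.Nat using (ℕ; _≥_; _⊓_)
open import Data.Product using (_×_)
open import Relation.Binary.PropositionalEquality using (_≡_)

open import Data.Nat as ℕ using (zero; suc)
import Data.Nat.Properties as ℕP
open import Data.Bool using (true; false; if_then_else_)
import Data.Bool.Properties as BoolP
open import Data.Integer as ℤ using (+_)
import Data.Integer.Properties as ℤP
open import Data.Rational using (ℚ; mkℚ; 0ℚ; 1ℚ; ½; _+_; _-_; -_; _*_)
open import Data.Rational.Properties
  using (normalize-coprime; toℚᵘ-injective; toℚᵘ-homo-+; +-identityʳ; +-identityˡ;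
         +-assoc; +-comm; *-zeroʳ; *-zeroˡ; *-identityʳ; *-identityˡ; neg-injective)
import Data.Rational.Unnormalised as U
import Data.Rational.Unnormalised.Properties as UP
open import Data.Nat.Coprimality using (1-coprimeTo) renaming (sym to coprime-sym)
open import Relation.Binary.PropositionalEquality
  using (refl; sym; trans; cong; cong₂; _≢_; ≢-sym; module ≡-Reasoning)
open import Data.List using ([]; _∷_; map; _++_)
open import Data.List.Properties using (map-++; map-∘)
open import Data.Vec using ([]; _∷_)
open import Data.Vec.Properties using (≡-dec; ∷-injectiveʳ)
open import Relation.Nullary using (does; ¬_)
open import Relation.Nullary.Decidable using (dec-true; dec-false)
open import Data.Sum using (_⊎_; inj₁; inj₂)
open import Data.Product using (_,_)
open import Function using (_∘_)
open import Data.Rational.Solver using (module +-*-Solver)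
open +-*-Solver using (solve; con; _:+_; _:-_; _:*_; :-_; _:=_)

ℕtoℚ-mkℚ : ∀ n → ℕtoℚ n ≡ mkℚ (+ n) 0 (coprime-sym (1-coprimeTo n))
ℕtoℚ-mkℚ n = normalize-coprime (coprime-sym (1-coprimeTo n))

ℕtoℚ-homo-+ : ∀ m n → ℕtoℚ (m ℕ.+ n) ≡ ℕtoℚ m + ℕtoℚ n
ℕtoℚ-homo-+ m n rewrite ℕtoℚ-mkℚ (m ℕ.+ n) | ℕtoℚ-mkℚ m | ℕtoℚ-mkℚ n =
  toℚᵘ-injective (UP.≃-trans (U.*≡* cross-multiplied) (UP.≃-sym (toℚᵘ-homo-+ (fraction m) (fraction n))))
  where
  fraction : ℕ → ℚ
  fraction k = mkℚ (+ k) 0 (coprime-sym (1-coprimeTo k))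
  cross-multiplied : + (m ℕ.+ n) ℤ.* (+ 1 ℤ.* + 1) ≡ (+ m ℤ.* + 1 ℤ.+ + n ℤ.* + 1) ℤ.* + 1
  cross-multiplied rewrite ℤP.*-identityʳ (+ m) | ℤP.*-identityʳ (+ n)
                         | ℤP.*-identityʳ (+ m ℤ.+ + n) = ℤP.pos-+ m n

negOnePow≢0 : ∀ i → negOnePow i ≢ 0ℚ
negOnePow≢0 zero ()
negOnePow≢0 (suc i) e = negOnePow≢0 i (neg-injective e)

dualEigenvalue : ℕ → ℕ → ℚ
dualEigenvalue D i = negOnePow i * (ℕtoℚ D - ℕtoℚ (2 ℕ.* i))

-- The average of θ at two consecutive distances is a sign:
-- ½ (θ i + θ (i+1)) = ½ ((-1)^i (D-2i) - (-1)^i (D-2i-2)) = (-1)^i.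
dualEigenvalue-average : ∀ D i →
  ½ * (dualEigenvalue D i + dualEigenvalue D (suc i)) ≡ negOnePow i
dualEigenvalue-average D i =
  begin
    ½ * (s * (d - ℕtoℚ (2 ℕ.* i)) + (- s) * (d - ℕtoℚ (2 ℕ.* suc i)))
  ≡⟨ cong (λ q → ½ * (s * (d - ℕtoℚ (2 ℕ.* i)) + (- s) * (d - q))) two-steps ⟩
    ½ * (s * (d - ℕtoℚ (2 ℕ.* i)) + (- s) * (d - (ℕtoℚ 2 + ℕtoℚ (2 ℕ.* i))))
  ≡⟨ telescope s d (ℕtoℚ (2 ℕ.* i)) ⟩
    s
  ∎
  where
  open ≡-Reasoning
  s = negOnePow i
  d = ℕtoℚ D
  two-steps : ℕtoℚ (2 ℕ.* suc i) ≡ ℕtoℚ 2 + ℕtoℚ (2 ℕ.* i)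
  two-steps = trans (cong ℕtoℚ (ℕP.*-suc 2 i)) (ℕtoℚ-homo-+ 2 (2 ℕ.* i))
  telescope : ∀ s d b → ½ * (s * (d - b) + (- s) * (d - (ℕtoℚ 2 + b))) ≡ s
  telescope = solve 3 (λ s d b →
    con ½ :* (s :* (d :- b) :+ (:- s) :* (d :- (con (ℕtoℚ 2) :+ b))) := s) refl

Consecutive : ℕ → ℕ → Set
Consecutive m n = n ≡ suc m ⊎ m ≡ suc n

dualEigenvalue-average-consecutive : ∀ D {m n} → Consecutive m n →
  ½ * (dualEigenvalue D m + dualEigenvalue D n) ≡ negOnePow (m ⊓ n)
dualEigenvalue-average-consecutive D {m} (inj₁ refl)
  rewrite ℕP.m≤n⇒m⊓n≡m (ℕP.n≤1+n m) = dualEigenvalue-average D m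
dualEigenvalue-average-consecutive D {n = n} (inj₂ refl)
  rewrite ℕP.m≥n⇒m⊓n≡n (ℕP.n≤1+n n)
        | +-comm (dualEigenvalue D (suc n)) (dualEigenvalue D n) = dualEigenvalue-average D n

sumℚ-++ : ∀ xs ys → sumℚ (xs ++ ys) ≡ sumℚ xs + sumℚ ys
sumℚ-++ [] ys = sym (+-identityˡ _)
sumℚ-++ (x ∷ xs) ys rewrite sumℚ-++ xs ys = sym (+-assoc x _ _)

sumℚ-zero : ∀ {A : Set} (g : A → ℚ) → (∀ w → g w ≡ 0ℚ) → ∀ xs → sumℚ (map g xs) ≡ 0ℚ
sumℚ-zero g g≡0 [] = refl
sumℚ-zero g g≡0 (x ∷ xs) rewrite g≡0 x | sumℚ-zero g g≡0 xs = refl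

sum-cube-split : ∀ D (g : Vertex (suc D) → ℚ) →
  sumℚ (map g (allVertices (suc D))) ≡
  sumℚ (map (λ w → g (false ∷ w)) (allVertices D)) + sumℚ (map (λ w → g (true ∷ w)) (allVertices D))
sum-cube-split D g
  rewrite map-++ g (map (false ∷_) (allVertices D)) (map (true ∷_) (allVertices D))
        | sumℚ-++ (map g (map (false ∷_) (allVertices D))) (map g (map (true ∷_) (allVertices D)))
        | sym (map-∘ {g = g} {f = false ∷_} (allVertices D))
        | sym (map-∘ {g = g} {f = true ∷_} (allVertices D)) = refl

-- Sifting: a function on 𝒳 supported at the single vertex z sums to its value at z.
-- (This uses that allVertices lists every vertex exactly once.)
sum-cube-sift : ∀ D (z : Vertex D) (g : Vertex D → ℚ) → (∀ w → w ≢ z → g w ≡ 0ℚ) →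
  sumℚ (map g (allVertices D)) ≡ g z
sum-cube-sift zero [] g _ = +-identityʳ _
sum-cube-sift (suc D) (false ∷ z) g supp
  rewrite sum-cube-split D g
        | sum-cube-sift D z (λ w → g (false ∷ w)) (λ w w≢z → supp _ (w≢z ∘ ∷-injectiveʳ))
        | sumℚ-zero (λ w → g (true ∷ w)) (λ w → supp (true ∷ w) (λ ())) (allVertices D)
  = +-identityʳ _
sum-cube-sift (suc D) (true ∷ z) g supp
  rewrite sum-cube-split D g
        | sum-cube-sift D z (λ w → g (true ∷ w)) (λ w w≢z → supp _ (w≢z ∘ ∷-injectiveʳ))
        | sumℚ-zero (λ w → g (false ∷ w)) (λ w → supp (false ∷ w) (λ ())) (allVertices D)
  = +-identityˡ _

diagonal : ∀ {D} → (Vertex D → ℚ) → Matrix D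
diagonal d y z = if does (≡-dec BoolP._≟_ y z) then d y else 0ℚ

diagonal-on : ∀ {D} (d : Vertex D → ℚ) y → diagonal d y y ≡ d y
diagonal-on d y rewrite dec-true (≡-dec BoolP._≟_ y y) refl = refl

diagonal-off : ∀ {D} (d : Vertex D → ℚ) {y z} → y ≢ z → diagonal d y z ≡ 0ℚ
diagonal-off d {y} {z} y≢z rewrite dec-false (≡-dec BoolP._≟_ y z) y≢z = refl

·-diagonalʳ : ∀ {D} (M : Matrix D) (d : Vertex D → ℚ) y z → (M · diagonal d) y z ≡ M y z * d z
·-diagonalʳ {D} M d y z =
  trans (sum-cube-sift D z (λ w → M y w * diagonal d w z)
           (λ w w≢z → trans (cong (M y w *_) (diagonal-off d w≢z)) (*-zeroʳ (M y w))))
        (cong (M y z *_) (diagonal-on d z))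

·-diagonalˡ : ∀ {D} (d : Vertex D → ℚ) (M : Matrix D) y z → (diagonal d · M) y z ≡ d y * M y z
·-diagonalˡ {D} d M y z =
  trans (sum-cube-sift D y (λ w → diagonal d y w * M w z)
           (λ w w≢y → trans (cong (_* M w z) (diagonal-off d (≢-sym w≢y))) (*-zeroˡ (M w z))))
        (cong (_* M y z) (diagonal-on d y))

hamming-0⇒≡ : ∀ {D} (u v : Vertex D) → hamming u v ≡ 0 → u ≡ v
hamming-0⇒≡ [] [] _ = refl
hamming-0⇒≡ (false ∷ u) (false ∷ v) h = cong (false ∷_) (hamming-0⇒≡ u v h)
hamming-0⇒≡ (true ∷ u) (true ∷ v) h = cong (true ∷_) (hamming-0⇒≡ u v h)

consecutive-+ : ∀ k {m n} → Consecutive m n → Consecutive (k ℕ.+ m) (k ℕ.+ n)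
consecutive-+ k (inj₁ e) = inj₁ (trans (cong (k ℕ.+_) e) (ℕP.+-suc k _))
consecutive-+ k (inj₂ e) = inj₂ (trans (cong (k ℕ.+_) e) (ℕP.+-suc k _))

-- Adjacent vertices lie at consecutive distances from any base vertex x
-- (flipping one coordinate changes the distance to x by exactly one).
adjacent⇒consecutive : ∀ {D} (x y z : Vertex D) → Adjacent y z →
  Consecutive (hamming x y) (hamming x z)
adjacent⇒consecutive (c ∷ x) (false ∷ y) (false ∷ z) h = consecutive-+ _ (adjacent⇒consecutive x y z h)
adjacent⇒consecutive (c ∷ x) (true ∷ y) (true ∷ z) h = consecutive-+ _ (adjacent⇒consecutive x y z h)
adjacent⇒consecutive (false ∷ x) (false ∷ y) (true ∷ z) h
  rewrite hamming-0⇒≡ y z (ℕP.suc-injective h) = inj₁ refl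
adjacent⇒consecutive (true ∷ x) (false ∷ y) (true ∷ z) h
  rewrite hamming-0⇒≡ y z (ℕP.suc-injective h) = inj₂ refl
adjacent⇒consecutive (false ∷ x) (true ∷ y) (false ∷ z) h
  rewrite hamming-0⇒≡ y z (ℕP.suc-injective h) = inj₂ refl
adjacent⇒consecutive (true ∷ x) (true ∷ y) (false ∷ z) h
  rewrite hamming-0⇒≡ y z (ℕP.suc-injective h) = inj₁ refl
adjacent⇒consecutive [] [] [] ()

adjMatrix-adjacent : ∀ D {y z} → Adjacent y z → adjMatrix D y z ≡ 1ℚ
adjMatrix-adjacent D h rewrite h = refl

adjMatrix-nonadjacent : ∀ D {y z} → ¬ Adjacent y z → adjMatrix D y z ≡ 0ℚ
adjMatrix-nonadjacent D {y} {z} ¬adj rewrite dec-false (hamming y z ℕP.≟ 1) ¬adj = refl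

Cmatrix-entry : ∀ D x y z →
  Cmatrix D x y z ≡
    ½ * (adjMatrix D y z * dualEigenvalue D (hamming x z) + dualEigenvalue D (hamming x y) * adjMatrix D y z)
Cmatrix-entry D x y z =
  cong₂ (λ p q → ½ * (p + q)) (·-diagonalʳ (adjMatrix D) θ y z) (·-diagonalˡ θ (adjMatrix D) y z)
  where
  θ : Vertex D → ℚ
  θ w = dualEigenvalue D (hamming x w)

Cmatrix-adjacent : ∀ D x y z → Adjacent y z →
  Cmatrix D x y z ≡ negOnePow (hamming x y ⊓ hamming x z)
Cmatrix-adjacent D x y z adj =
  begin
    Cmatrix D x y z
  ≡⟨ Cmatrix-entry D x y z ⟩
    ½ * (adjMatrix D y z * θz + θy * adjMatrix D y z)
  ≡⟨ cong (λ a → ½ * (a * θz + θy * a)) (adjMatrix-adjacent D {y} {z} adj) ⟩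
    ½ * (1ℚ * θz + θy * 1ℚ)
  ≡⟨ cong₂ (λ p q → ½ * (p + q)) (*-identityˡ θz) (*-identityʳ θy) ⟩
    ½ * (θz + θy)
  ≡⟨ cong (½ *_) (+-comm θz θy) ⟩
    ½ * (θy + θz)
  ≡⟨ dualEigenvalue-average-consecutive D (adjacent⇒consecutive x y z adj) ⟩
    negOnePow (hamming x y ⊓ hamming x z)
  ∎
  where
  open ≡-Reasoning
  θy = dualEigenvalue D (hamming x y)
  θz = dualEigenvalue D (hamming x z)

Cmatrix-nonadjacent : ∀ D x y z → ¬ Adjacent y z → Cmatrix D x y z ≡ 0ℚ
Cmatrix-nonadjacent D x y z ¬adj =
  begin
    Cmatrix D x y z
  ≡⟨ Cmatrix-entry D x y z ⟩
    ½ * (adjMatrix D y z * θz + θy * adjMatrix D y z)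
  ≡⟨ cong (λ a → ½ * (a * θz + θy * a)) (adjMatrix-nonadjacent D {y} {z} ¬adj) ⟩
    ½ * (0ℚ * θz + θy * 0ℚ)
  ≡⟨ cong₂ (λ p q → ½ * (p + q)) (*-zeroˡ θz) (*-zeroʳ θy) ⟩
    ½ * 0ℚ
  ≡⟨ *-zeroʳ ½ ⟩
    0ℚ
  ∎
  where
  open ≡-Reasoning
  θy = dualEigenvalue D (hamming x y)
  θz = dualEigenvalue D (hamming x z)

-- Proposition 13.4: 𝐂 is supported exactly on the edges of Q_D, where it is a sign.
proposition13p4 : (D : ℕ) → D ≥ 1 → (x : Vertex D) →
    IsWeightedAdjacency D (Cmatrix D x) ×
    (∀ (y z : Vertex D) → Adjacent y z →
    Cmatrix D x y z ≡ negOnePow (hamming x y ⊓ hamming x z))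
proposition13p4 D _ x = (nonzero-on-edges , Cmatrix-nonadjacent D x) , Cmatrix-adjacent D x
  where
  nonzero-on-edges : ∀ y z → Adjacent y z → Cmatrix D x y z ≢ 0ℚ
  nonzero-on-edges y z adj C≡0 =
    negOnePow≢0 (hamming x y ⊓ hamming x z) (trans (sym (Cmatrix-adjacent D x y z adj)) C≡0)
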